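{- Let $\mathcal T$ be a tangle of order $k$ in a connectivity system $(E,\lambda)$. Let $n\ge4$ and let $\Phi=(P_1,\dots,P_n)$ be a $\mathcal T$-strong partition of $E$. If $P_i\cup P_{i+1}$ is $k$-separating for each $i\in\{1,\dots,n-1\}$, then $\Phi$ is a $k$-flower in $\mathcal T$.
   Context: A connectivity system is a pair $(E,\lambda)$ with $E$ finite and $\lambda$ an integer-valued symmetric ($\lambda(X)=\lambda(E-X)$) submodular function on subsets of $E$. $X$ is $k$-separating if $\lambda(X)\le k$. A tangle of order $k$ is a collection $\mathcal T$ of subsets of $E$ with (T1) $\lambda(A)<k$ for $A\in\mathcal T$; (T2) if $\lambda(A)\le k-1$ then $A\in\mathcal T$ or $E-A\in\mathcal T$; (T3) no three members have union $E$; (T4) $E-\{e\}\notin\mathcal T$. $X$ is $\mathcal T$-weak if contained in a member of $\mathcal T$, else $\mathcal T$-strong; a partition of $E$ is $\mathcal T$-strong if all its parts are. A $k$-flower in $\mathcal T$ is a $\mathcal T$-strong partition $(P_1,\dots,P_n)$ of $E$ such that for all $i$, both $P_i$ and $P_i\cup P_{i+1}$ are $k$-separating, indices taken modulo $n$. -}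

module Defs where

open import Data.Nat using (ℕ; suc; _<_; _≤_; s≤s; z≤n)
open import Data.Nat.Properties using (m<n⇒m≤1+n)
open import Data.Integer as ℤ using (ℤ; _+_; +_; _-_)
open import Data.Fin using (Fin; toℕ; fromℕ<)
open import Data.Fin.Subset using (Subset; _∪_; _∩_; ∁; _⊆_; _∈_; ⊤; ⁅_⁆)
open import Data.Sum using (_⊎_)
open import Data.Product using (Σ; ∃; _×_; _,_)
open import Data.Nat.DivMod using (_%_; m%n<n)
open import Relation.Nullary using (¬_)
open import Relation.Binary.PropositionalEquality using (_≡_; _≢_)

record ConnectivitySystem (m : ℕ) : Set where
  field
    λc : Subset m → ℤ
    symmetric : ∀ X → λc X ≡ λc (∁ X)
    submodular : ∀ X Y → (λc (X ∪ Y) + λc (X ∩ Y)) ℤ.≤ (λc X + λc Y)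
open ConnectivitySystem public

kSeparating : ∀ {m} → ConnectivitySystem m → ℤ → Subset m → Set
kSeparating K k X = λc K X ℤ.≤ k

record IsTangle {m : ℕ} (K : ConnectivitySystem m) (k : ℤ) (𝒯 : Subset m → Set) : Set where
  field
    T1 : ∀ A → 𝒯 A → λc K A ℤ.< k
    T2 : ∀ A → λc K A ℤ.≤ (k - + 1) → 𝒯 A ⊎ 𝒯 (∁ A)
    T3 : ∀ A B C → 𝒯 A → 𝒯 B → 𝒯 C → ¬ (((A ∪ B) ∪ C) ≡ ⊤)
    T4 : ∀ e → ¬ 𝒯 (∁ ⁅ e ⁆)

Weak : ∀ {m} → (Subset m → Set) → Subset m → Set
Weak 𝒯 X = ∃ λ A → 𝒯 A × X ⊆ A

Strong : ∀ {m} → (Subset m → Set) → Subset m → Set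
Strong 𝒯 X = ¬ Weak 𝒯 X

IsPartition : ∀ {m n} → (Fin n → Subset m) → Set
IsPartition {m} {n} P =
  (∀ (e : Fin m) → ∃ λ i → e ∈ P i) ×
  (∀ (e : Fin m) (i j : Fin n) → e ∈ P i → e ∈ P j → i ≡ j)

StrongPartition : ∀ {m n} → (Subset m → Set) → (Fin n → Subset m) → Set
StrongPartition 𝒯 P = IsPartition P × (∀ i → Strong 𝒯 (P i))

next : ∀ {n} → Fin n → Fin n
next {suc n} i = fromℕ< (m%n<n (suc (toℕ i)) (suc n))

IsFlower : ∀ {m n} → ConnectivitySystem m → ℤ → (Subset m → Set) → (Fin n → Subset m) → Set
IsFlower K k 𝒯 P =
  StrongPartition 𝒯 P ×
  (∀ i → kSeparating K k (P i)) ×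
  (∀ i → kSeparating K k (P i ∪ P (next i)))

module Submission where

-- Two consequences of the tangle axioms drive the proof.
--   * A set whose two sides each contain a 𝒯-strong set has λ ≥ k (by T2).
--   * Submodularity then "uncrosses": if λ X, λ Y ≤ k and one of X ∩ Y,
--     X ∪ Y has λ ≥ k, the other one has λ ≤ k.
-- Each part P_j is k-separating: it is the intersection of the k-separating
-- sets P_j ∪ P_{j±1} and E - (P_{j±1} ∪ P_{j±2}), whose union is E - P_{j±2},
-- which separates two strong parts (n ≥ 4 makes one of the two directions fit).
-- For the missing pair P_{n-1} ∪ P₀ we show by induction on t that
-- P₁ ∪ … ∪ P_t is k-separating for t ≤ n-2, gluing on P_t ∪ P_{t+1} along
-- the strong part P_t; the missing pair is the complement of P₁ ∪ … ∪ P_{n-2}.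
-- The argument runs on the family extended by ∅ to all of ℕ, so that index
-- arithmetic happens in ℕ; the final section translates back to Fin n.

open import Defs
open import Data.Nat using (ℕ; suc; _≤_; _<_)
open import Data.Integer using (ℤ)
open import Data.Fin using (Fin; toℕ)
open import Data.Fin.Subset using (Subset; _∪_)

open import Data.Nat using (zero; z≤n; s≤s; _<?_)
import Data.Nat.Properties as ℕP
open import Data.Nat.DivMod using (_%_; m<n⇒m%n≡m; n%n≡0)
open import Data.Integer as ℤ using (_+_; -1ℤ)
import Data.Integer.Properties as ℤP
open import Data.Fin using (fromℕ<)
open import Data.Fin.Properties using (toℕ-fromℕ<; fromℕ<-toℕ; toℕ<n)
open import Data.Fin.Subset using (_∩_; ∁; _⊆_; _∈_; ⊥)
open import Data.Fin.Subset.Properties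
  using (_∈?_; x∈p∪q⁺; x∈p∪q⁻; x∈p∩q⁺; x∈p∩q⁻; x∈∁p⇒x∉p; x∉p⇒x∈∁p; ∉⊥; ⊆-antisym;
         ∪-assoc; ∪-idem; ∪-comm; ∪-identityˡ)
open import Data.Sum using (inj₁; inj₂; [_,_])
open import Data.Product using (∃; _×_; _,_; proj₁; proj₂)
open import Data.Empty renaming (⊥ to Empty) using (⊥-elim)
open import Relation.Nullary using (yes; no)
open import Relation.Binary.PropositionalEquality
  using (_≡_; refl; sym; trans; cong; cong₂; subst; module ≡-Reasoning)

≤-from-sum : ∀ {a b c d k : ℤ} →
  a + b ℤ.≤ c + d → c ℤ.≤ k → d ℤ.≤ k → k ℤ.≤ b → a ℤ.≤ k
≤-from-sum {a} {b} {c} {d} {k} sum c≤k d≤k k≤b = ℤP.≮⇒≥ λ k<a →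
  ℤP.<-irrefl refl (begin-strict
    k + k  <⟨ ℤP.+-mono-<-≤ k<a k≤b ⟩
    a + b  ≤⟨ sum ⟩
    c + d  ≤⟨ ℤP.+-mono-≤ c≤k d≤k ⟩
    k + k  ∎)
  where open ℤP.≤-Reasoning

Disjoint : ∀ {m} → Subset m → Subset m → Set
Disjoint A B = ∀ {x} → x ∈ A → x ∈ B → Empty

disjoint⇒⊆∁ : ∀ {m} {A B : Subset m} → Disjoint A B → A ⊆ ∁ B
disjoint⇒⊆∁ A#B x∈A = x∉p⇒x∈∁p (A#B x∈A)

uncross-∩ : ∀ {m} (A B C : Subset m) → Disjoint A B → Disjoint A C →
  (A ∪ B) ∩ ∁ (B ∪ C) ≡ A
uncross-∩ A B C A#B A#C = ⊆-antisym ⊆A A⊆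
  where
  ⊆A : (A ∪ B) ∩ ∁ (B ∪ C) ⊆ A
  ⊆A x∈ with x∈p∩q⁻ (A ∪ B) (∁ (B ∪ C)) x∈
  ... | x∈A∪B , x∉B∪C with x∈p∪q⁻ A B x∈A∪B
  ...   | inj₁ x∈A = x∈A
  ...   | inj₂ x∈B = ⊥-elim (x∈∁p⇒x∉p x∉B∪C (x∈p∪q⁺ (inj₁ x∈B)))
  A⊆ : A ⊆ (A ∪ B) ∩ ∁ (B ∪ C)
  A⊆ x∈A = x∈p∩q⁺ (x∈p∪q⁺ (inj₁ x∈A) ,
    x∉p⇒x∈∁p (λ x∈B∪C → [ A#B x∈A , A#C x∈A ] (x∈p∪q⁻ B C x∈B∪C)))

uncross-∪ : ∀ {m} (A B C : Subset m) → Disjoint A C → Disjoint B C →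
  (A ∪ B) ∪ ∁ (B ∪ C) ≡ ∁ C
uncross-∪ A B C A#C B#C = ⊆-antisym ⊆∁C ∁C⊆
  where
  ⊆∁C : (A ∪ B) ∪ ∁ (B ∪ C) ⊆ ∁ C
  ⊆∁C x∈ with x∈p∪q⁻ (A ∪ B) (∁ (B ∪ C)) x∈
  ... | inj₁ x∈A∪B = x∉p⇒x∈∁p (λ x∈C → [ (λ x∈A → A#C x∈A x∈C) , (λ x∈B → B#C x∈B x∈C) ]
                                          (x∈p∪q⁻ A B x∈A∪B))
  ... | inj₂ x∉B∪C = x∉p⇒x∈∁p (λ x∈C → x∈∁p⇒x∉p x∉B∪C (x∈p∪q⁺ (inj₂ x∈C)))
  ∁C⊆ : ∁ C ⊆ (A ∪ B) ∪ ∁ (B ∪ C)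
  ∁C⊆ {x} x∉C with x ∈? B
  ... | yes x∈B = x∈p∪q⁺ (inj₁ (x∈p∪q⁺ (inj₂ x∈B)))
  ... | no x∉B = x∈p∪q⁺ (inj₂ (x∉p⇒x∈∁p (λ x∈B∪C →
                   [ x∉B , x∈∁p⇒x∉p x∉C ] (x∈p∪q⁻ B C x∈B∪C))))

∪-overlap : ∀ {m} (A B C : Subset m) → (A ∪ B) ∪ (B ∪ C) ≡ (A ∪ B) ∪ C
∪-overlap A B C = begin
  (A ∪ B) ∪ (B ∪ C)   ≡⟨ ∪-assoc A B (B ∪ C) ⟩
  A ∪ (B ∪ (B ∪ C))   ≡⟨ cong (A ∪_) (sym (∪-assoc B B C)) ⟩
  A ∪ ((B ∪ B) ∪ C)   ≡⟨ cong (λ Z → A ∪ (Z ∪ C)) (∪-idem B) ⟩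
  A ∪ (B ∪ C)         ≡⟨ sym (∪-assoc A B C) ⟩
  (A ∪ B) ∪ C         ∎
  where open ≡-Reasoning

∩-∪-disjoint : ∀ {m} (S B C : Subset m) → B ⊆ S → Disjoint S C → S ∩ (B ∪ C) ≡ B
∩-∪-disjoint S B C B⊆S S#C = ⊆-antisym ⊆B B⊆
  where
  ⊆B : S ∩ (B ∪ C) ⊆ B
  ⊆B x∈ with x∈p∩q⁻ S (B ∪ C) x∈
  ... | x∈S , x∈B∪C = [ (λ x∈B → x∈B) , (λ x∈C → ⊥-elim (S#C x∈S x∈C)) ] (x∈p∪q⁻ B C x∈B∪C)
  B⊆ : B ⊆ S ∩ (B ∪ C)
  B⊆ x∈B = x∈p∩q⁺ (B⊆S x∈B , x∈p∪q⁺ (inj₁ x∈B))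

module TangleFacts {m : ℕ} (K : ConnectivitySystem m) (k : ℤ) (𝒯 : Subset m → Set)
  (tangle : IsTangle K k 𝒯) where

  open IsTangle tangle

  kSep : Subset m → Set
  kSep = kSeparating K k

  ∁-kSep : ∀ X → kSep X → kSep (∁ X)
  ∁-kSep X = subst (ℤ._≤ k) (symmetric K X)

  -- If both X and E - X contain a 𝒯-strong set, then λ X ≥ k: otherwise T2
  -- puts X or E - X into 𝒯, making one of the strong sets weak.
  strong-sides⇒order-≥ : ∀ X S S' → Strong 𝒯 S → S ⊆ X → Strong 𝒯 S' → S' ⊆ ∁ X →
    k ℤ.≤ λc K X
  strong-sides⇒order-≥ X S S' S-strong S⊆X S'-strong S'⊆∁X = ℤP.≮⇒≥ λ λX<k →
    [ (λ X∈𝒯 → S-strong (X , X∈𝒯 , S⊆X)) , (λ ∁X∈𝒯 → S'-strong (∁ X , ∁X∈𝒯 , S'⊆∁X)) ]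
      (T2 X (subst (λc K X ℤ.≤_) (ℤP.+-comm -1ℤ k) (ℤP.i<j⇒i≤pred[j] λX<k)))

  glue-kSep : ∀ X Y → kSep X → kSep Y → k ℤ.≤ λc K (X ∩ Y) → kSep (X ∪ Y)
  glue-kSep X Y = ≤-from-sum (submodular K X Y)

  meet-kSep : ∀ X Y → kSep X → kSep Y → k ℤ.≤ λc K (X ∪ Y) → kSep (X ∩ Y)
  meet-kSep X Y = ≤-from-sum
    (subst (ℤ._≤ λc K X + λc K Y) (ℤP.+-comm (λc K (X ∪ Y)) (λc K (X ∩ Y))) (submodular K X Y))

  -- For pairwise disjoint A, B, C with A and C strong, k-separating A ∪ B
  -- and B ∪ C force A to be k-separating: A = (A ∪ B) ∩ (E - (B ∪ C)) and
  -- the union E - C of these two sets separates the strong sets A and C.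
  end-of-triple : ∀ A B C → Disjoint A B → Disjoint A C → Disjoint B C →
    Strong 𝒯 A → Strong 𝒯 C → kSep (A ∪ B) → kSep (B ∪ C) → kSep A
  end-of-triple A B C A#B A#C B#C A-strong C-strong AB-sep BC-sep =
    subst kSep (uncross-∩ A B C A#B A#C)
      (meet-kSep (A ∪ B) (∁ (B ∪ C)) AB-sep (∁-kSep (B ∪ C) BC-sep)
        (subst (λ Z → k ℤ.≤ λc K Z) (sym (uncross-∪ A B C A#C B#C)) order-∁C))
    where
    order-∁C : k ℤ.≤ λc K (∁ C)
    order-∁C = subst (k ℤ.≤_) (symmetric K C)
      (strong-sides⇒order-≥ C C A C-strong (λ x∈C → x∈C) A-strong (disjoint⇒⊆∁ A#C))

  module Chain (n : ℕ) (4≤n : 4 ≤ n) (Q : ℕ → Subset m)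
    (same-part : ∀ {a b x} → x ∈ Q a → x ∈ Q b → a ≡ b)
    (covered : ∀ x → ∃ λ j → j < n × x ∈ Q j)
    (strong : ∀ {j} → j < n → Strong 𝒯 (Q j))
    (adjacent : ∀ j → suc j < n → kSep (Q j ∪ Q (suc j))) where

    <⇒disjoint : ∀ {a b} → a < b → Disjoint (Q a) (Q b)
    <⇒disjoint a<b x∈Qa x∈Qb = ℕP.<⇒≢ a<b (same-part x∈Qa x∈Qb)

    >⇒disjoint : ∀ {a b} → b < a → Disjoint (Q a) (Q b)
    >⇒disjoint b<a x∈Qa x∈Qb = ℕP.<⇒≢ b<a (same-part x∈Qb x∈Qa)

    run-ends-kSep : ∀ j → suc (suc j) < n → kSep (Q j) × kSep (Q (suc (suc j)))
    run-ends-kSep j j+2<n =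
      end-of-triple (Q j) (Q (suc j)) (Q (suc (suc j)))
        (<⇒disjoint j<j+1) (<⇒disjoint j<j+2) (<⇒disjoint j+1<j+2)
        (strong j<n) (strong j+2<n) (adjacent j j+1<n) (adjacent (suc j) j+2<n) ,
      end-of-triple (Q (suc (suc j))) (Q (suc j)) (Q j)
        (>⇒disjoint j+1<j+2) (>⇒disjoint j<j+2) (>⇒disjoint j<j+1)
        (strong j+2<n) (strong j<n)
        (subst kSep (∪-comm (Q (suc j)) (Q (suc (suc j)))) (adjacent (suc j) j+2<n))
        (subst kSep (∪-comm (Q j) (Q (suc j))) (adjacent j j+1<n))
      where
      j<j+1 : j < suc j
      j<j+1 = ℕP.n<1+n j
      j+1<j+2 : suc j < suc (suc j)
      j+1<j+2 = ℕP.n<1+n (suc j)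
      j<j+2 : j < suc (suc j)
      j<j+2 = ℕP.<-trans j<j+1 j+1<j+2
      j+1<n : suc j < n
      j+1<n = ℕP.<-trans j+1<j+2 j+2<n
      j<n : j < n
      j<n = ℕP.<-trans j<j+2 j+2<n

    -- Every part is k-separating: parts 0 and 1 start a run (as n ≥ 4),
    -- every later part ends one.
    part-kSep : ∀ j → j < n → kSep (Q j)
    part-kSep 0             _     = proj₁ (run-ends-kSep 0 (ℕP.<-≤-trans (s≤s (s≤s (s≤s z≤n))) 4≤n))
    part-kSep 1             _     = proj₁ (run-ends-kSep 1 4≤n)
    part-kSep (suc (suc j)) j+2<n = proj₂ (run-ends-kSep j j+2<n)

    Span : ℕ → Subset m
    Span zero    = ⊥
    Span (suc t) = Span t ∪ Q (suc t)

    span-member⁻ : ∀ {x} t → x ∈ Span t → ∃ λ l → l < t × x ∈ Q (suc l)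
    span-member⁻ zero    x∈ = ⊥-elim (∉⊥ x∈)
    span-member⁻ (suc t) x∈ with x∈p∪q⁻ (Span t) (Q (suc t)) x∈
    ... | inj₂ x∈Q = t , ℕP.n<1+n t , x∈Q
    ... | inj₁ x∈S with span-member⁻ t x∈S
    ...   | l , l<t , x∈Ql = l , ℕP.m<n⇒m<1+n l<t , x∈Ql

    span-member⁺ : ∀ {x} t l → l < t → x ∈ Q (suc l) → x ∈ Span t
    span-member⁺ (suc t) l l<t+1 x∈Q with ℕP.m≤n⇒m<n∨m≡n (ℕP.≤-pred l<t+1)
    ... | inj₁ l<t  = x∈p∪q⁺ (inj₁ (span-member⁺ t l l<t x∈Q))
    ... | inj₂ refl = x∈p∪q⁺ (inj₂ x∈Q)

    -- Q 1 ∪ … ∪ Q (t+1) is k-separating while t + 1 < n: glue on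
    -- Q (t+1) ∪ Q (t+2) along Q (t+1), which separates strong parts from Q 0.
    span-kSep : ∀ t → suc t < n → kSep (Span (suc t))
    span-kSep zero    1<n = subst kSep (sym (∪-identityˡ (Q 1))) (part-kSep 1 1<n)
    span-kSep (suc t) t+2<n =
      subst kSep (∪-overlap (Span t) (Q (suc t)) (Q (suc (suc t))))
        (glue-kSep (Span (suc t)) (Q (suc t) ∪ Q (suc (suc t)))
          (span-kSep t t+1<n) (adjacent (suc t) t+2<n)
          (subst (λ Z → k ℤ.≤ λc K Z) (sym span-meets-pair) middle-order))
      where
      t+1<n : suc t < n
      t+1<n = ℕP.<-trans (ℕP.n<1+n (suc t)) t+2<n
      span#next : Disjoint (Span (suc t)) (Q (suc (suc t)))
      span#next x∈S x∈Q with span-member⁻ (suc t) x∈S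
      ... | l , l<t+1 , x∈Ql = <⇒disjoint (s≤s l<t+1) x∈Ql x∈Q
      span-meets-pair : Span (suc t) ∩ (Q (suc t) ∪ Q (suc (suc t))) ≡ Q (suc t)
      span-meets-pair = ∩-∪-disjoint _ _ _ (λ x∈Q → x∈p∪q⁺ (inj₂ x∈Q)) span#next
      middle-order : k ℤ.≤ λc K (Q (suc t))
      middle-order = strong-sides⇒order-≥ (Q (suc t)) (Q (suc t)) (Q 0)
        (strong t+1<n) (λ x∈Q → x∈Q)
        (strong (ℕP.<-trans (s≤s z≤n) t+1<n)) (disjoint⇒⊆∁ (<⇒disjoint (s≤s z≤n)))

    span-complement : ∀ t → suc (suc (suc t)) ≡ n → ∁ (Span (suc t)) ≡ Q (suc (suc t)) ∪ Q 0
    span-complement t refl = ⊆-antisym ⊆ends ends⊆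
      where
      ⊆ends : ∁ (Span (suc t)) ⊆ Q (suc (suc t)) ∪ Q 0
      ⊆ends {x} x∉S with covered x
      ... | zero  , _     , x∈Q0 = x∈p∪q⁺ (inj₂ x∈Q0)
      ... | suc l , l+1<n , x∈Q with l <? suc t
      ...   | yes l<t+1 = ⊥-elim (x∈∁p⇒x∉p x∉S (span-member⁺ (suc t) l l<t+1 x∈Q))
      ...   | no  l≮t+1 = x∈p∪q⁺ (inj₁ (subst (λ j → x ∈ Q (suc j)) l≡t+1 x∈Q))
        where
        l≡t+1 : l ≡ suc t
        l≡t+1 = ℕP.≤-antisym (ℕP.≤-pred (ℕP.≤-pred l+1<n)) (ℕP.≮⇒≥ l≮t+1)
      ends⊆ : Q (suc (suc t)) ∪ Q 0 ⊆ ∁ (Span (suc t))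
      ends⊆ {x} x∈ends = x∉p⇒x∈∁p λ x∈S → case (span-member⁻ (suc t) x∈S)
        where
        case : (∃ λ l → l < suc t × x ∈ Q (suc l)) → Empty
        case (l , l<t+1 , x∈Ql) =
          [ <⇒disjoint (s≤s l<t+1) x∈Ql , >⇒disjoint (s≤s z≤n) x∈Ql ]
            (x∈p∪q⁻ (Q (suc (suc t))) (Q 0) x∈ends)

    last-pair-kSep : ∀ j → suc j ≡ n → kSep (Q j ∪ Q 0)
    last-pair-kSep (suc (suc t)) n≡t+3 =
      subst kSep (span-complement t n≡t+3) (∁-kSep (Span (suc t)) (span-kSep t t+1<n))
      where
      t+1<n : suc t < n
      t+1<n = subst (suc t <_) n≡t+3 (ℕP.m<n⇒m<1+n (ℕP.n<1+n (suc t)))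
    last-pair-kSep 0       refl = ⊥-elim (ℕP.≤⇒≯ 4≤n (s≤s (s≤s z≤n)))
    last-pair-kSep 1       refl = ⊥-elim (ℕP.≤⇒≯ 4≤n (s≤s (s≤s (s≤s z≤n))))

next-inner : ∀ {n} (i : Fin n) → suc (toℕ i) < n → toℕ (next i) ≡ suc (toℕ i)
next-inner {suc _} i i+1<n = trans (toℕ-fromℕ< _) (m<n⇒m%n≡m i+1<n)

next-last : ∀ {n} (i : Fin n) → suc (toℕ i) ≡ n → toℕ (next i) ≡ 0
next-last {suc n} i i+1≡n = trans (toℕ-fromℕ< _) (trans (cong (_% suc n) i+1≡n) (n%n≡0 (suc n)))

extend : ∀ {m n} → (Fin n → Subset m) → ℕ → Subset m
extend {n = n} P j with j <? n
... | yes j<n = P (fromℕ< j<n)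
... | no  _   = ⊥

module _ {m n : ℕ} (P : Fin n → Subset m) where

  extend-fromℕ< : ∀ {j} (j<n : j < n) → extend P j ≡ P (fromℕ< j<n)
  extend-fromℕ< {j} j<n with j <? n
  ... | yes _   = refl
  ... | no  j≮n = ⊥-elim (j≮n j<n)

  extend-toℕ : ∀ i → extend P (toℕ i) ≡ P i
  extend-toℕ i = trans (extend-fromℕ< (toℕ<n i)) (cong P (fromℕ<-toℕ i (toℕ<n i)))

  extend-member : ∀ {x j} → x ∈ extend P j → ∃ λ i → toℕ i ≡ j × x ∈ P i
  extend-member {x} {j} x∈ with j <? n
  ... | yes j<n = fromℕ< j<n , toℕ-fromℕ< j<n , x∈
  ... | no  _   = ⊥-elim (∉⊥ x∈)

  extend-same-part : IsPartition P → ∀ {a b x} → x ∈ extend P a → x ∈ extend P b → a ≡ b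
  extend-same-part (_ , unique) x∈a x∈b with extend-member x∈a | extend-member x∈b
  ... | i , refl , x∈Pi | i' , refl , x∈Pi' = cong toℕ (unique _ i i' x∈Pi x∈Pi')

  extend-covered : IsPartition P → ∀ x → ∃ λ j → j < n × x ∈ extend P j
  extend-covered (cover , _) x with cover x
  ... | i , x∈Pi = toℕ i , toℕ<n i , subst (x ∈_) (sym (extend-toℕ i)) x∈Pi

  extend-adjacent : {R : Subset m → Set} →
    (∀ i → suc (toℕ i) < n → R (P i ∪ P (next i))) →
    ∀ j → suc j < n → R (extend P j ∪ extend P (suc j))
  extend-adjacent {R} pairs j j+1<n =
    subst R (cong₂ _∪_ (sym (extend-fromℕ< j<n)) P-next) (pairs i i+1<n)
    where
    j<n : j < n
    j<n = ℕP.<-trans (ℕP.n<1+n j) j+1<n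
    i : Fin n
    i = fromℕ< j<n
    i+1<n : suc (toℕ i) < n
    i+1<n = subst (λ l → suc l < n) (sym (toℕ-fromℕ< j<n)) j+1<n
    P-next : P (next i) ≡ extend P (suc j)
    P-next = trans (sym (extend-toℕ (next i)))
      (cong (extend P) (trans (next-inner i i+1<n) (cong suc (toℕ-fromℕ< j<n))))

  extend-last : ∀ i → suc (toℕ i) ≡ n → P i ∪ P (next i) ≡ extend P (toℕ i) ∪ extend P 0
  extend-last i i+1≡n = cong₂ _∪_ (sym (extend-toℕ i))
    (trans (sym (extend-toℕ (next i))) (cong (extend P) (next-last i i+1≡n)))

lemma4p2 : (m : ℕ) (K : ConnectivitySystem m) (k : ℤ) (𝒯 : Subset m → Set) →
    IsTangle K k 𝒯 →
    (n : ℕ) → 4 ≤ n → (P : Fin n → Subset m) →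
    StrongPartition 𝒯 P →
    (∀ (i : Fin n) → suc (toℕ i) < n → kSeparating K k (P i ∪ P (next i))) →
    IsFlower K k 𝒯 P
lemma4p2 m K k 𝒯 tangle n 4≤n P (partition , strong) adjacent =
  (partition , strong) , parts-kSep , pairs-kSep
  where
  open TangleFacts K k 𝒯 tangle
  open Chain n 4≤n (extend P) (extend-same-part P partition) (extend-covered P partition)
    (λ j<n → subst (Strong 𝒯) (sym (extend-fromℕ< P j<n)) (strong _))
    (extend-adjacent P {kSep} adjacent)

  parts-kSep : ∀ i → kSep (P i)
  parts-kSep i = subst kSep (extend-toℕ P i) (part-kSep (toℕ i) (toℕ<n i))

  pairs-kSep : ∀ i → kSep (P i ∪ P (next i))
  pairs-kSep i with ℕP.m≤n⇒m<n∨m≡n (toℕ<n i)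
  ... | inj₁ i+1<n = adjacent i i+1<n
  ... | inj₂ i+1≡n = subst kSep (sym (extend-last P i i+1≡n)) (last-pair-kSep (toℕ i) i+1≡n)
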